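{- Let $n\ge 2$ be an integer and let $C$ be the graceful colouring of $K_{n+1}$. Then $K_{n+1}$ contains at least $2^{\lfloor\frac{n-1}{2}\rfloor}$ different heterochromatic spanning trees.
   Context: The graceful colouring of $K_{n+1}$: label the vertices $v_0,v_1,\ldots,v_n$ and give the edge $v_sv_t$ the colour $|s-t|\in\{1,\ldots,n\}$. A subgraph is heterochromatic if all its edges have different colours. -}

module Defs where

open import Data.Nat using (ℕ; zero; suc; _≤_; ∣_-_∣)
open import Data.Fin using (Fin; toℕ; inject₁; fromℕ)
open import Data.Bool using (Bool; true; false)
open import Data.Product using (Σ; _×_; ∃; ∃-syntax)
open import Data.Sum using (_⊎_)
open import Data.Empty using (⊥)
open import Relation.Nullary using (¬_)
open import Relation.Binary.PropositionalEquality using (_≡_; _≢_)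
open import Function.Definitions using (Injective)

Vertex : ℕ → Set
Vertex n = Fin (suc n)

-- Graceful colouring: the edge v_s v_t gets colour |s - t|.
colour : {n : ℕ} → Vertex n → Vertex n → ℕ
colour s t = ∣ toℕ s - toℕ t ∣

-- A spanning subgraph of K_{n+1}, given by its (decidable) adjacency.
-- It is a simple graph when the adjacency is symmetric and irreflexive.
Subgraph : ℕ → Set
Subgraph n = Vertex n → Vertex n → Bool

Adj : {n : ℕ} → Subgraph n → Vertex n → Vertex n → Set
Adj E u v = E u v ≡ true

IsSimple : {n : ℕ} → Subgraph n → Set
IsSimple E = (∀ u v → E u v ≡ E v u) × (∀ u → E u u ≡ false)

data Walk {n : ℕ} (E : Subgraph n) : Vertex n → Vertex n → Set where
  here : ∀ {u} → Walk E u u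
  step : ∀ {u v w} → Adj E u v → Walk E v w → Walk E u w

Connected : {n : ℕ} → Subgraph n → Set
Connected E = ∀ u v → Walk E u v

-- A cycle: distinct vertices c_0, …, c_m (m ≥ 2, i.e. length ≥ 3)
-- with c_i c_{i+1} and c_m c_0 edges of E.
record Cycle {n : ℕ} (E : Subgraph n) : Set where
  field
    m      : ℕ
    long   : 2 ≤ m
    c      : Fin (suc m) → Vertex n
    inj    : Injective _≡_ _≡_ c
    adj    : ∀ (i : Fin m) → Adj E (c (inject₁ i)) (c (Fin.suc i))
    close  : Adj E (c (fromℕ m)) (c Fin.zero)

Acyclic : {n : ℕ} → Subgraph n → Set
Acyclic E = ¬ Cycle E

IsSpanningTree : {n : ℕ} → Subgraph n → Set
IsSpanningTree E = IsSimple E × Connected E × Acyclic E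

-- Heterochromatic: distinct edges have distinct colours, i.e. two edges
-- {u,v}, {x,y} of E with the same colour are the same edge.
Heterochromatic : {n : ℕ} → Subgraph n → Set
Heterochromatic E = ∀ u v x y → Adj E u v → Adj E x y →
  colour u v ≡ colour x y →
  (u ≡ x × v ≡ y) ⊎ (u ≡ y × v ≡ x)

Different : {n : ℕ} → Subgraph n → Subgraph n → Set
Different E F = ∃[ u ] ∃[ v ] E u v ≢ F u v

-- Take the double star in which v₀ and vₙ are joined by the edge of colour n and every other
-- vertex vₐ hangs from v₀ (colour a) or from vₙ (colour n − a). If vₐ and vₙ₋ₐ always hang
-- from the same centre, the pair {a, n − a} uses exactly the colours a and n − a, so the tree
-- is heterochromatic. The ⌊(n − 1)/2⌋ pairs with a < n − a can be oriented independently,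
-- and two different choices already differ in the edges at v₀.
module Submission where

open import Defs
open import Data.Nat using (ℕ; _≤_; _∸_; _^_; _/_)
open import Data.Fin using (Fin)
open import Data.Product using (Σ; _×_)
open import Relation.Binary.PropositionalEquality using (_≢_)

open import Data.Nat as ℕ using (zero; suc; _<_; _+_; _*_; _⊓_; ∣_-_∣; z≤n; s≤s; NonZero; >-nonZero; ≢-nonZero⁻¹)
open import Data.Nat.Properties
open import Data.Nat.DivMod using (m/n*n≤m)
open import Data.Fin as Fin using (toℕ; fromℕ; fromℕ<; finToFun; funToFin; combine; #_)
open import Data.Fin.Properties using (toℕ-injective; toℕ-fromℕ; toℕ-fromℕ<; fromℕ<-toℕ; toℕ<n; toℕ≤pred[n]; funToFin-finToFin; ¬∀⟶∃¬; 2↔Bool)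
open import Data.Bool using (Bool; true; false; not; _∨_; if_then_else_)
open import Data.Bool.Properties using (∨-comm; ∨-identityʳ; not-injective)
open import Data.Product using (_,_; ∃-syntax; ∃₂; swap)
open import Data.Sum using (_⊎_; inj₁; inj₂; [_,_]′)
open import Data.Empty using (⊥; ⊥-elim)
open import Function using (_∘_)
open import Function.Bundles using (Inverse; Injection)
open import Function.Properties.Inverse using (↔⇒↣)
open import Relation.Nullary using (¬_; Dec; yes; no; does; ¬?; _×-dec_; contradiction)
open import Relation.Nullary.Decidable using (dec-true; dec-false)
open import Relation.Binary.PropositionalEquality using (_≡_; refl; sym; trans; cong; cong₂; _≗_; module ≡-Reasoning)

module _ {n : ℕ} {E : Subgraph n} where

  _◅◅_ : ∀ {u v w} → Walk E u v → Walk E v w → Walk E u w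
  here     ◅◅ q = q
  step a p ◅◅ q = step a (p ◅◅ q)

  module _ (E-sym : ∀ u v → E u v ≡ E v u) where

    Adj-sym : ∀ {u v} → Adj E u v → Adj E v u
    Adj-sym {u} {v} a = trans (E-sym v u) a

    reverse : ∀ {u v} → Walk E u v → Walk E v u
    reverse here       = here
    reverse (step a p) = reverse p ◅◅ step (Adj-sym a) here

    walksTo⇒connected : ∀ r → (∀ u → Walk E u r) → Connected E
    walksTo⇒connected r to-r u v = to-r u ◅◅ reverse (to-r v)

Branching : {n : ℕ} → Subgraph n → Vertex n → Set
Branching E x = ∃₂ λ a b → a ≢ b × Adj E x a × Adj E x b

three-distinct∉pair : {A : Set} {h₁ h₂ x y z : A} → x ≢ y → y ≢ z → x ≢ z →
  x ≡ h₁ ⊎ x ≡ h₂ → y ≡ h₁ ⊎ y ≡ h₂ → z ≡ h₁ ⊎ z ≡ h₂ → ⊥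
three-distinct∉pair x≢y _   _   (inj₁ p) (inj₁ q) _        = x≢y (trans p (sym q))
three-distinct∉pair x≢y _   _   (inj₂ p) (inj₂ q) _        = x≢y (trans p (sym q))
three-distinct∉pair _   y≢z _   _        (inj₁ q) (inj₁ r) = y≢z (trans q (sym r))
three-distinct∉pair _   y≢z _   _        (inj₂ q) (inj₂ r) = y≢z (trans q (sym r))
three-distinct∉pair _   _   x≢z (inj₁ p) (inj₂ _) (inj₁ r) = x≢z (trans p (sym r))
three-distinct∉pair _   _   x≢z (inj₂ p) (inj₁ _) (inj₂ r) = x≢z (trans p (sym r))

-- On a cycle c₀ … cₘ (m ≥ 2) the three vertices c₀, c₁, cₘ are distinct and all branching.
twoBranchVertices⇒acyclic : {n : ℕ} {E : Subgraph n} → (∀ u v → E u v ≡ E v u) →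
  (h₁ h₂ : Vertex n) → (∀ x → Branching E x → x ≡ h₁ ⊎ x ≡ h₂) → Acyclic E
twoBranchVertices⇒acyclic _ _ _ _ record { m = 0 ; long = () }
twoBranchVertices⇒acyclic _ _ _ _ record { m = 1 ; long = s≤s () }
twoBranchVertices⇒acyclic E-sym h₁ h₂ branching⇒hub record
  { m = suc (suc k) ; c = c ; inj = inj ; adj = adj ; close = close } =
  three-distinct∉pair (distinct (# 0) (# 1) (λ ())) (distinct (# 1) m (λ ())) (distinct (# 0) m (λ ()))
    (branching⇒hub (c (# 0))
      (c (# 1) , c m , distinct (# 1) m (λ ()) , adj (# 0) , Adj-sym E-sym close))
    (branching⇒hub (c (# 1))
      (c (# 0) , c (# 2) , distinct (# 0) (# 2) (λ ()) , Adj-sym E-sym (adj (# 0)) , adj (# 1)))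
    (branching⇒hub (c m)
      (c (# 0) , c m-1 , distinct (# 0) m-1 (λ ()) , close , Adj-sym E-sym (adj (fromℕ (suc k)))))
  where
  m m-1 : Fin (3 + k)
  m   = fromℕ (2 + k)
  m-1 = Fin.inject₁ (fromℕ (suc k))
  distinct : ∀ i j → i ≢ j → c i ≢ c j
  distinct i j i≢j = i≢j ∘ inj

colour-sym : {n : ℕ} (s t : Vertex n) → colour s t ≡ colour t s
colour-sym s t = ∣-∣-comm (toℕ s) (toℕ t)

module DoubleStar (n : ℕ) .{{_ : NonZero n}} (side : ℕ → Bool) (side-n : side n ≡ false) where

  top : Vertex n
  top = fromℕ n

  top≢zero : top ≢ Fin.zero
  top≢zero top≡0 = ≢-nonZero⁻¹ n (trans (sym (toℕ-fromℕ n)) (cong toℕ top≡0))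

  hub : Bool → Vertex n
  hub false = Fin.zero
  hub true  = top

  parent : Vertex n → Vertex n
  parent u = hub (side (toℕ u))

  parent-top : parent top ≡ Fin.zero
  parent-top = cong hub (trans (cong side (toℕ-fromℕ n)) side-n)

  HangsFrom : Vertex n → Vertex n → Set
  HangsFrom u v = u ≢ Fin.zero × parent u ≡ v

  hangsFrom? : ∀ u v → Dec (HangsFrom u v)
  hangsFrom? u v = ¬? (u Fin.≟ Fin.zero) ×-dec (parent u Fin.≟ v)

  tree : Subgraph n
  tree u v = does (hangsFrom? u v) ∨ does (hangsFrom? v u)

  tree-sym : ∀ u v → tree u v ≡ tree v u
  tree-sym u v = ∨-comm (does (hangsFrom? u v)) (does (hangsFrom? v u))

  Adj⇒hangs : ∀ {u v} → Adj tree u v → HangsFrom u v ⊎ HangsFrom v u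
  Adj⇒hangs {u} {v} = cases (hangsFrom? u v) (hangsFrom? v u)
    where
    cases : (p : Dec (HangsFrom u v)) (q : Dec (HangsFrom v u)) →
            does p ∨ does q ≡ true → HangsFrom u v ⊎ HangsFrom v u
    cases (yes h) _       _  = inj₁ h
    cases (no _)  (yes h) _  = inj₂ h
    cases (no _)  (no _)  ()

  hangs⇒Adj : ∀ {u v} → HangsFrom u v → Adj tree u v
  hangs⇒Adj {u} {v} h rewrite dec-true (hangsFrom? u v) h = refl

  hangs-to-hub : ∀ {u v} → HangsFrom u v → v ≡ Fin.zero ⊎ v ≡ top
  hangs-to-hub {u} (_ , refl) with side (toℕ u)
  ... | false = inj₁ refl
  ... | true  = inj₂ refl

  ¬hangs-self : ∀ u → ¬ HangsFrom u u
  ¬hangs-self u (u≢0 , parent-u≡u) with hangs-to-hub (u≢0 , parent-u≡u)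
  ... | inj₁ u≡0   = u≢0 u≡0
  ... | inj₂ refl  = top≢zero (trans (sym parent-u≡u) parent-top)

  isSimple : IsSimple tree
  isSimple = tree-sym , λ u → cong₂ _∨_ (dec-false (hangsFrom? u u) (¬hangs-self u))
                                         (dec-false (hangsFrom? u u) (¬hangs-self u))

  walk-to-zero : ∀ u → Walk tree u Fin.zero
  walk-to-zero u with u Fin.≟ Fin.zero
  ... | yes refl = here
  ... | no u≢0   = step (hangs⇒Adj (u≢0 , refl)) (hub-to-zero (side (toℕ u)))
    where
    hub-to-zero : ∀ b → Walk tree (hub b) Fin.zero
    hub-to-zero false = here
    hub-to-zero true  = step (hangs⇒Adj (top≢zero , parent-top)) here

  leaf-neighbour : ∀ {x y} → x ≢ Fin.zero → x ≢ top → Adj tree x y → y ≡ parent x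
  leaf-neighbour x≢0 x≢top xy with Adj⇒hangs xy
  ... | inj₁ (_ , parent-x≡y) = sym parent-x≡y
  ... | inj₂ y-hangs-from-x   = ⊥-elim ([ x≢0 , x≢top ]′ (hangs-to-hub y-hangs-from-x))

  branching⇒hub : ∀ x → Branching tree x → x ≡ Fin.zero ⊎ x ≡ top
  branching⇒hub x (a , b , a≢b , xa , xb) = by-cases (x Fin.≟ Fin.zero) (x Fin.≟ top)
    where
    by-cases : Dec (x ≡ Fin.zero) → Dec (x ≡ top) → x ≡ Fin.zero ⊎ x ≡ top
    by-cases (yes x≡0)  _           = inj₁ x≡0
    by-cases (no _)     (yes x≡top) = inj₂ x≡top
    by-cases (no x≢0)   (no x≢top)  =
      contradiction (trans (leaf-neighbour x≢0 x≢top xa) (sym (leaf-neighbour x≢0 x≢top xb))) a≢b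

  isSpanningTree : IsSpanningTree tree
  isSpanningTree = isSimple ,
                   walksTo⇒connected tree-sym Fin.zero walk-to-zero ,
                   twoBranchVertices⇒acyclic tree-sym Fin.zero top branching⇒hub

  tree-to-zero : ∀ {w} → w ≢ Fin.zero → tree w Fin.zero ≡ not (side (toℕ w))
  tree-to-zero {w} w≢0 = begin
    does (hangsFrom? w Fin.zero) ∨ does (hangsFrom? Fin.zero w)
      ≡⟨ cong (does (hangsFrom? w Fin.zero) ∨_) (dec-false (hangsFrom? Fin.zero w) λ (0≢0 , _) → 0≢0 refl) ⟩
    does (hangsFrom? w Fin.zero) ∨ false
      ≡⟨ ∨-identityʳ _ ⟩
    does (hangsFrom? w Fin.zero)
      ≡⟨ hangs-to-zero (side (toℕ w)) refl ⟩
    not (side (toℕ w))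
      ∎
    where
    open ≡-Reasoning
    hangs-to-zero : ∀ b → side (toℕ w) ≡ b → does (hangsFrom? w Fin.zero) ≡ not b
    hangs-to-zero false s = dec-true (hangsFrom? w Fin.zero) (w≢0 , cong hub s)
    hangs-to-zero true  s = dec-false (hangsFrom? w Fin.zero) λ (_ , p) → top≢zero (trans (cong hub (sym s)) p)

  sideColour : ℕ → ℕ
  sideColour a = if side a then n ∸ a else a

  hanging-colour : ∀ {u v} → HangsFrom u v → colour u v ≡ sideColour (toℕ u)
  hanging-colour {u} (_ , refl) with side (toℕ u)
  ... | false = ∣-∣-identityʳ (toℕ u)
  ... | true  = trans (cong (λ t → ∣ toℕ u - t ∣) (toℕ-fromℕ n)) (m≤n⇒∣m-n∣≡n∸m (toℕ≤pred[n] u))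

  module _ (side-sym : ∀ a → a ≤ n → side a ≡ side (n ∸ a)) where

    mirror-sides : ∀ {a c} → c ≤ n → side a ≡ false → side c ≡ true → a ≢ n ∸ c
    mirror-sides {c = c} c≤n sa sc refl with trans (sym sa) (trans (sym (side-sym c c≤n)) sc)
    ... | ()

    sideColour-injective : ∀ {a c} → a ≤ n → c ≤ n → sideColour a ≡ sideColour c → a ≡ c
    sideColour-injective {a} {c} a≤n c≤n e with side a in sa | side c in sc
    ... | false | false = e
    ... | true  | true  = ∸-cancelˡ-≡ a≤n c≤n e
    ... | false | true  = contradiction e (mirror-sides c≤n sa sc)
    ... | true  | false = contradiction (sym e) (mirror-sides a≤n sc sa)

    same-colour⇒same-edge : ∀ {u v x y} → HangsFrom u v → HangsFrom x y →
                            colour u v ≡ colour x y → u ≡ x × v ≡ y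
    same-colour⇒same-edge {u} {x = x} hu@(_ , refl) hx@(_ , refl) e = u≡x , cong parent u≡x
      where
      u≡x : u ≡ x
      u≡x = toℕ-injective (sideColour-injective (toℕ≤pred[n] u) (toℕ≤pred[n] x)
                             (trans (sym (hanging-colour hu)) (trans e (hanging-colour hx))))

    heterochromatic : Heterochromatic tree
    heterochromatic u v x y uv xy e with Adj⇒hangs uv | Adj⇒hangs xy
    ... | inj₁ hu | inj₁ hx = inj₁ (same-colour⇒same-edge hu hx e)
    ... | inj₁ hu | inj₂ hy = inj₂ (same-colour⇒same-edge hu hy (trans e (colour-sym x y)))
    ... | inj₂ hv | inj₁ hx = inj₂ (swap (same-colour⇒same-edge hv hx (trans (colour-sym v u) e)))
    ... | inj₂ hv | inj₂ hy = inj₁ (swap (same-colour⇒same-edge hv hy (trans (colour-sym v u) (trans e (colour-sym x y)))))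

pairIndex : ℕ → ℕ → ℕ
pairIndex n a = a ⊓ (n ∸ a)

pairIndex-mirror : ∀ {n a} → a ≤ n → pairIndex n a ≡ pairIndex n (n ∸ a)
pairIndex-mirror {n} {a} a≤n =
  trans (⊓-comm a (n ∸ a)) (cong ((n ∸ a) ⊓_) (sym (m∸[m∸n]≡n a≤n)))

pairIndex-n : ∀ n → pairIndex n n ≡ 0
pairIndex-n n = trans (cong (n ⊓_) (n∸n≡0 n)) (⊓-zeroʳ n)

pairIndex-low : ∀ {n a} → a + a ≤ n → pairIndex n a ≡ a
pairIndex-low {a = a} a+a≤n = m≤n⇒m⊓n≡m (m+n≤o⇒m≤o∸n a a+a≤n)

-- Pair 0 is the pair of hubs {0, n}; the pair k + 1 = {k + 1, n ∸ (k + 1)} hangs on the side β k.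
pairBit : (ℕ → Bool) → ℕ → Bool
pairBit β zero    = false
pairBit β (suc k) = β k

pairSide : ℕ → (ℕ → Bool) → ℕ → Bool
pairSide n β a = pairBit β (pairIndex n a)

module PairedDoubleStar (n : ℕ) .{{_ : NonZero n}} (β : ℕ → Bool) =
  DoubleStar n (pairSide n β) (cong (pairBit β) (pairIndex-n n))

pairedTree : (n : ℕ) .{{_ : NonZero n}} → (ℕ → Bool) → Subgraph n
pairedTree n β = PairedDoubleStar.tree n β

pairedTree-isHeterochromaticSpanningTree : (n : ℕ) .{{_ : NonZero n}} (β : ℕ → Bool) →
  IsSpanningTree (pairedTree n β) × Heterochromatic (pairedTree n β)
pairedTree-isHeterochromaticSpanningTree n β =
  isSpanningTree , heterochromatic (λ a a≤n → cong (pairBit β) (pairIndex-mirror a≤n))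
  where open PairedDoubleStar n β

pairedTree-differ : (n : ℕ) .{{_ : NonZero n}} {β γ : ℕ → Bool} (b : ℕ) →
  suc b + suc b ≤ n → β b ≢ γ b → Different (pairedTree n β) (pairedTree n γ)
pairedTree-differ n {β} {γ} b fits βb≢γb =
  w , Fin.zero , λ e → βb≢γb (not-injective (trans (sym (to-zero β)) (trans e (to-zero γ))))
  where
  b+1<n+1 : suc b < suc n
  b+1<n+1 = s≤s (≤-trans (m≤m+n (suc b) (suc b)) fits)
  w : Vertex n
  w = fromℕ< b+1<n+1
  toℕ-w : toℕ w ≡ suc b
  toℕ-w = toℕ-fromℕ< b+1<n+1
  w≢0 : w ≢ Fin.zero
  w≢0 w≡0 with trans (sym toℕ-w) (cong toℕ w≡0)
  ... | ()
  to-zero : ∀ δ → pairedTree n δ w Fin.zero ≡ not (δ b)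
  to-zero δ = trans (PairedDoubleStar.tree-to-zero n δ w≢0)
                    (cong (not ∘ pairBit δ) (trans (cong (pairIndex n) toℕ-w) (pairIndex-low fits)))

funToFin-cong : ∀ {m k} {f g : Fin m → Fin k} → f ≗ g → funToFin f ≡ funToFin g
funToFin-cong {zero}  _   = refl
funToFin-cong {suc m} f≗g = cong₂ combine (f≗g Fin.zero) (funToFin-cong (f≗g ∘ Fin.suc))

finToFun-injective : ∀ {m k} {i j : Fin (k ^ m)} → finToFun {k} {m} i ≗ finToFun j → i ≡ j
finToFun-injective {m} {k} {i} {j} i≗j = begin
  i                              ≡⟨ funToFin-finToFin {m} {k} i ⟨
  funToFin (finToFun {k} {m} i)  ≡⟨ funToFin-cong i≗j ⟩
  funToFin (finToFun {k} {m} j)  ≡⟨ funToFin-finToFin {m} {k} j ⟩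
  j                              ∎
  where open ≡-Reasoning

bitsOf : ∀ K → Fin (2 ^ K) → ℕ → Bool
bitsOf K i b with b ℕ.<? K
... | yes b<K = Inverse.to 2↔Bool (finToFun {2} {K} i (fromℕ< b<K))
... | no _    = false

bitsOf-toℕ : ∀ K (i : Fin (2 ^ K)) (c : Fin K) →
  bitsOf K i (toℕ c) ≡ Inverse.to 2↔Bool (finToFun {2} {K} i c)
bitsOf-toℕ K i c with toℕ c ℕ.<? K
... | yes c<K = cong (Inverse.to 2↔Bool ∘ finToFun {2} {K} i) (fromℕ<-toℕ c c<K)
... | no c≮K  = contradiction (toℕ<n c) c≮K

bitsOf-separates : ∀ K {i j : Fin (2 ^ K)} → i ≢ j → ∃[ b ] b < K × bitsOf K i b ≢ bitsOf K j b
bitsOf-separates K {i} {j} i≢j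
  with c , differ ← ¬∀⟶∃¬ K (λ c → finToFun {2} {K} i c ≡ finToFun j c)
                            (λ c → finToFun {2} {K} i c Fin.≟ finToFun j c)
                            (i≢j ∘ finToFun-injective {K} {2})
  = toℕ c , toℕ<n c , λ e →
    differ (Injection.injective (↔⇒↣ 2↔Bool) (trans (sym (bitsOf-toℕ K i c)) (trans e (bitsOf-toℕ K j c))))

bit-fits : ∀ {n b} → b < (n ∸ 1) / 2 → suc b + suc b ≤ n
bit-fits {n} {b} b<K = begin
  suc b + suc b        ≡⟨ cong (suc b +_) (sym (+-identityʳ (suc b))) ⟩
  2 * suc b            ≡⟨ *-comm 2 (suc b) ⟩
  suc b * 2            ≤⟨ *-monoˡ-≤ 2 b<K ⟩
  (n ∸ 1) / 2 * 2      ≤⟨ m/n*n≤m (n ∸ 1) 2 ⟩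
  n ∸ 1                ≤⟨ m∸n≤m n 1 ⟩
  n                    ∎
  where open ≤-Reasoning

corollary1 : (n : ℕ) → 2 ≤ n →
    Σ (Fin (2 ^ ((n ∸ 1) / 2)) → Subgraph n) λ T →
      (∀ i → IsSpanningTree (T i) × Heterochromatic (T i)) ×
      (∀ i j → i ≢ j → Different (T i) (T j))
corollary1 n 2≤n =
  (λ i → pairedTree n (bitsOf K i)) ,
  (λ i → pairedTree-isHeterochromaticSpanningTree n (bitsOf K i)) ,
  distinct
  where
  K : ℕ
  K = (n ∸ 1) / 2
  instance
    n-nonZero : NonZero n
    n-nonZero = >-nonZero (≤-trans (s≤s z≤n) 2≤n)
  distinct : ∀ i j → i ≢ j → Different (pairedTree n (bitsOf K i)) (pairedTree n (bitsOf K j))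
  distinct i j i≢j with b , b<K , bits-differ ← bitsOf-separates K i≢j
    = pairedTree-differ n b (bit-fits b<K) bits-differ
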